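{- Let $d\in\mathbb{N}$, $\mathbf{s}=(s_1,\dots,s_d)\in\mathbb{N}^d$, and let $l_1(n),\dots,l_d(n)\in\{2n,2n+1,2n-1\}$. Then \[ \sum_{n_0>n_1\succ n_2\succ\cdots\succ n_d\succ0}\frac{a_{n_0}}{(2n_0-1)\,l_1(n_1)^{s_1}\cdots l_d(n_d)^{s_d}}=\sum_{n_1\succ n_2\succ\cdots\succ n_d\succ0}\frac{a_{n_1}}{l_1(n_1)^{s_1}\cdots l_d(n_d)^{s_d}}, \] where each "$\succ$" can be either "$\ge$" or "$>$" (the same choices on both sides), provided the series is defined.
   Context: For $n\in\mathbb{N}_0$, $a_n=\frac{1}{4^n}\binom{2n}{n}$. -}

module Defs where

open import Data.Bool using (Bool; true; false)
open import Data.Nat as ℕ using (ℕ; zero; suc)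
open import Data.Nat.Combinatorics using (_C_)
open import Data.Nat.Properties using (m^n≢0)
open import Data.Integer as ℤ using (ℤ; +_)
open import Data.Rational using (ℚ; 0ℚ; 1ℚ; _+_; _*_; _-_; _/_; 1/_; ≢-nonZero; ∣_∣; _<_; Positive)
open import Data.Rational.Properties using (_≟_)
open import Data.Vec using (Vec; []; _∷_)
open import Data.Product using (Σ; _×_; ∃-syntax)
open import Relation.Nullary using (yes; no)
open import Relation.Binary.PropositionalEquality using (_≢_)

_^ℚ_ : ℚ → ℕ → ℚ
q ^ℚ zero  = 1ℚ
q ^ℚ suc n = q * (q ^ℚ n)

-- totalised inverse (only ever applied to nonzero arguments under the
-- "series is defined" hypothesis of the theorem)
inv : ℚ → ℚ
inv q with q ≟ 0ℚ
... | yes _ = 0ℚ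
... | no q≢0 = 1/_ q {{≢-nonZero q≢0}}

a : ℕ → ℚ
a n = (+ ((2 ℕ.* n) C n)) / (4 ℕ.^ n)
  where instance _ = m^n≢0 4 n

ι : ℕ → ℚ
ι n = (+ n) / 1

data LChoice : Set where
  twoN twoN+1 twoN-1 : LChoice

lval : LChoice → ℕ → ℚ
lval twoN   n = ι (2 ℕ.* n)
lval twoN+1 n = ι (2 ℕ.* n) + 1ℚ
lval twoN-1 n = ι (2 ℕ.* n) - 1ℚ

sumBelow : ℕ → (ℕ → ℚ) → ℚ
sumBelow zero    f = 0ℚ
sumBelow (suc k) f = sumBelow k f + f k

-- choice of "≻": true = ">", false = "≥".
-- Rel c n m  means  n ≻ m
Rel : Bool → ℕ → ℕ → Set
Rel true  n m = m ℕ.< n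
Rel false n m = m ℕ.≤ n

sumPrec : Bool → ℕ → (ℕ → ℚ) → ℚ
sumPrec true  n f = sumBelow n f
sumPrec false n f = sumBelow (suc n) f

ind0 : Bool → ℕ → ℚ
ind0 true  zero    = 0ℚ
ind0 true  (suc _) = 1ℚ
ind0 false _       = 1ℚ

-- G cs ls ss n : for the data (c_i, l_i, s_i)_{i=k..d} and n_k = n,
--   Σ_{n ≻ n_{k+1} ≻ ... ≻ n_d ≻ 0} 1/(l_k(n)^{s_k} l_{k+1}(n_{k+1})^{s_{k+1}} ⋯ l_d(n_d)^{s_d})
-- where c_i is the choice of ≻ between n_i and n_{i+1} (n_{d+1} := 0).
G : ∀ {k} → Vec Bool (suc k) → Vec LChoice (suc k) → Vec ℕ (suc k) → ℕ → ℚ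
G (c ∷ [])     (l ∷ [])     (s ∷ [])     n = inv (lval l n ^ℚ s) * ind0 c n
G (c ∷ c′ ∷ cs) (l ∷ l′ ∷ ls) (s ∷ s′ ∷ ss) n =
  inv (lval l n ^ℚ s) * sumPrec c n (G (c′ ∷ cs) (l′ ∷ ls) (s′ ∷ ss))

Comp : ∀ {k} → Vec Bool (suc k) → ℕ → Set
Comp (c ∷ [])      n = Rel c n 0
Comp (c ∷ c′ ∷ cs) n = ∃[ m ] (Rel c n m × Comp (c′ ∷ cs) m)

-- Defined cs ls ss n : every denominator l_i(n_i) occurring in a summation
-- tuple (n_k = n ≻ ... ≻ n_d ≻ 0) is nonzero
Defined : ∀ {k} → Vec Bool (suc k) → Vec LChoice (suc k) → Vec ℕ (suc k) → ℕ → Set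
Defined (c ∷ [])     (l ∷ [])     (s ∷ [])     n = Rel c n 0 → lval l n ≢ 0ℚ
Defined (c ∷ c′ ∷ cs) (l ∷ l′ ∷ ls) (s ∷ s′ ∷ ss) n =
  (Comp (c ∷ c′ ∷ cs) n → lval l n ≢ 0ℚ) ×
  (∀ m → Rel c n m → Defined (c′ ∷ cs) (l′ ∷ ls) (s′ ∷ ss) m)

RHSPartial : ∀ {k} → Vec Bool (suc k) → Vec LChoice (suc k) → Vec ℕ (suc k) → ℕ → ℚ
RHSPartial cs ls ss N = sumBelow (suc N) (λ n₁ → a n₁ * G cs ls ss n₁)

LHSPartial : ∀ {k} → Vec Bool (suc k) → Vec LChoice (suc k) → Vec ℕ (suc k) → ℕ → ℚ
LHSPartial cs ls ss N =
  sumBelow (suc N) (λ n₀ → a n₀ * inv (ι (2 ℕ.* n₀) - 1ℚ) * sumBelow n₀ (G cs ls ss))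

Cauchy : (ℕ → ℚ) → Set
Cauchy f = ∀ (ε : ℚ) → Positive ε → ∃[ N ] (∀ M K → N ℕ.≤ M → N ℕ.≤ K → ∣ f M - f K ∣ < ε)

SameLimit : (ℕ → ℚ) → (ℕ → ℚ) → Set
SameLimit f g = ∀ (ε : ℚ) → Positive ε → ∃[ N ] (∀ M → N ℕ.≤ M → ∣ f M - g M ∣ < ε)

{-# OPTIONS --safe #-}
-- Fix the inner sums g(n) (= G) and put S_N = Σ_{n ≤ N} g(n). Since (2n+2) a_{n+1} = (2n+1) a_n,
-- i.e. a_n = a_{n+1} (1 + 1/(2n+1)), the partial sums L_N, R_N of the two sides satisfy
--   R_N − L_N = a_N S_N   and   (2N+2) (L_{N+1} − L_N) = R_N − L_N.
-- So the gap y_N = R_N − L_N drives the increments of L: if |y| stayed above c on [P, 2P), then L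
-- would move by at least c/4 there, against the Cauchy property of L. As y is Cauchy too, y_N → 0.
module Submission where

open import Defs
open import Data.Nat using (ℕ)
open import Data.Rational using (ℚ)

module CentralBinomial where
  open import Data.Nat
  open import Data.Nat.Properties
  open import Data.Nat.Combinatorics using (_C_; k![n∸k]!∣n!)
  open import Data.Nat.Combinatorics.Specification using (nCk≡n!/k![n-k]!)
  open import Data.Nat.DivMod using (m/n*n≡m)
  open import Data.Nat.Tactic.RingSolver using (solve-∀)
  open import Relation.Binary.PropositionalEquality
  open ≡-Reasoning

  nCk*k!*[n∸k]!≡n! : ∀ {n k} → k ≤ n → (n C k) * (k ! * (n ∸ k) !) ≡ n !
  nCk*k!*[n∸k]!≡n! {n} {k} k≤n =
    trans (cong (_* (k ! * (n ∸ k) !)) (nCk≡n!/k![n-k]! k≤n)) (m/n*n≡m (k![n∸k]!∣n! k≤n))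
    where instance _ = k !* (n ∸ k) !≢0

  [2n]Cn*n!*n!≡[2n]! : ∀ n → ((2 * n) C n) * (n ! * n !) ≡ (2 * n) !
  [2n]Cn*n!*n!≡[2n]! n =
    subst (λ m → ((2 * n) C n) * (n ! * m !) ≡ (2 * n) !) 2n∸n≡n (nCk*k!*[n∸k]!≡n! (m≤m+n n (n + 0)))
    where
    2n∸n≡n : 2 * n ∸ n ≡ n
    2n∸n≡n = trans (m+n∸m≡n n (n + 0)) (+-identityʳ n)

  [2+2n]*[2+2n]C[1+n]≡4*[1+2n]*[2n]Cn : ∀ n → 2 * suc n * ((2 * suc n) C suc n) ≡ 4 * suc (2 * n) * ((2 * n) C n)
  [2+2n]*[2+2n]C[1+n]≡4*[1+2n]*[2n]Cn n = *-cancelʳ-≡ _ _ (suc n ! * suc n !) {{suc n !* suc n !≢0}} (begin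
    2 * suc n * C₁ * (suc n ! * suc n !)                      ≡⟨ *-assoc (2 * suc n) C₁ _ ⟩
    2 * suc n * (C₁ * (suc n ! * suc n !))                    ≡⟨ cong (2 * suc n *_) ([2n]Cn*n!*n!≡[2n]! (suc n)) ⟩
    2 * suc n * (2 * suc n) !                                 ≡⟨ cong (λ m → 2 * suc n * m !) (2[1+n]≡2+2n n) ⟩
    2 * suc n * ((2 + 2 * n) * ((1 + 2 * n) * (2 * n) !))     ≡⟨ cong (λ f → 2 * suc n * ((2 + 2 * n) * ((1 + 2 * n) * f))) ([2n]Cn*n!*n!≡[2n]! n) ⟨
    2 * suc n * ((2 + 2 * n) * ((1 + 2 * n) * (C₀ * (n ! * n !)))) ≡⟨ rearrange n C₀ (n !) ⟩
    4 * suc (2 * n) * C₀ * (suc n ! * suc n !)                ∎)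
    where
    C₀ = (2 * n) C n
    C₁ = (2 * suc n) C suc n
    2[1+n]≡2+2n : ∀ n → 2 * suc n ≡ 2 + 2 * n
    2[1+n]≡2+2n = solve-∀
    rearrange : ∀ n c f → 2 * (1 + n) * ((2 + 2 * n) * ((1 + 2 * n) * (c * (f * f))))
                          ≡ 4 * (1 + 2 * n) * c * (((1 + n) * f) * ((1 + n) * f))
    rearrange = solve-∀

module NatCast where
  open import Data.Nat as ℕ using (suc)
  import Data.Nat.Properties as ℕ
  open import Data.Integer as ℤ using (+_)
  import Data.Integer.Properties as ℤ
  open import Data.Rational
  open import Data.Rational.Properties
  open import Data.Rational.Unnormalised as ℚᵘ using (mkℚᵘ; *≡*)
  import Data.Rational.Unnormalised.Properties as ℚᵘ
  open import Relation.Binary.PropositionalEquality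
  open import Data.Integer.Tactic.RingSolver using (solve-∀)

  toℚᵘ-/ : ∀ i d .{{_ : ℕ.NonZero d}} → toℚᵘ (i / d) ℚᵘ.≃ mkℚᵘ i (ℕ.pred d)
  toℚᵘ-/ i (suc d) = toℚᵘ-fromℚᵘ (mkℚᵘ i d)

  ι-+ : ∀ m n → ι (m ℕ.+ n) ≡ ι m + ι n
  ι-+ m n = toℚᵘ-injective (begin
    toℚᵘ (ι (m ℕ.+ n))                          ≈⟨ toℚᵘ-/ (+ (m ℕ.+ n)) 1 ⟩
    mkℚᵘ (+ (m ℕ.+ n)) 0                        ≈⟨ *≡* (trans (cong (ℤ._* + 1) (ℤ.pos-+ m n)) (distrib (+ m) (+ n))) ⟩
    mkℚᵘ (+ m) 0 ℚᵘ.+ mkℚᵘ (+ n) 0              ≈⟨ ℚᵘ.+-cong (toℚᵘ-/ (+ m) 1) (toℚᵘ-/ (+ n) 1) ⟨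
    toℚᵘ (ι m) ℚᵘ.+ toℚᵘ (ι n)                  ≈⟨ toℚᵘ-homo-+ (ι m) (ι n) ⟨
    toℚᵘ (ι m + ι n)                            ∎)
    where
    open ℚᵘ.≃-Reasoning
    distrib : ∀ x y → (x ℤ.+ y) ℤ.* + 1 ≡ (x ℤ.* + 1 ℤ.+ y ℤ.* + 1) ℤ.* + 1
    distrib = solve-∀

  ι-* : ∀ m n → ι (m ℕ.* n) ≡ ι m * ι n
  ι-* m n = toℚᵘ-injective (begin
    toℚᵘ (ι (m ℕ.* n))                          ≈⟨ toℚᵘ-/ (+ (m ℕ.* n)) 1 ⟩
    mkℚᵘ (+ (m ℕ.* n)) 0                        ≈⟨ *≡* (cong (ℤ._* + 1) (ℤ.pos-* m n)) ⟩
    mkℚᵘ (+ m) 0 ℚᵘ.* mkℚᵘ (+ n) 0              ≈⟨ ℚᵘ.*-cong (toℚᵘ-/ (+ m) 1) (toℚᵘ-/ (+ n) 1) ⟨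
    toℚᵘ (ι m) ℚᵘ.* toℚᵘ (ι n)                  ≈⟨ toℚᵘ-homo-* (ι m) (ι n) ⟨
    toℚᵘ (ι m * ι n)                            ∎)
    where open ℚᵘ.≃-Reasoning

  [+n/d]*ι[d]≡ι[n] : ∀ n d .{{_ : ℕ.NonZero d}} → (+ n / d) * ι d ≡ ι n
  [+n/d]*ι[d]≡ι[n] n d@(suc d-1) = toℚᵘ-injective (begin
    toℚᵘ ((+ n / d) * ι d)                      ≈⟨ toℚᵘ-homo-* (+ n / d) (ι d) ⟩
    toℚᵘ (+ n / d) ℚᵘ.* toℚᵘ (ι d)              ≈⟨ ℚᵘ.*-cong (toℚᵘ-/ (+ n) d) (toℚᵘ-/ (+ d) 1) ⟩
    mkℚᵘ (+ n) d-1 ℚᵘ.* mkℚᵘ (+ d) 0            ≈⟨ *≡* (cancel (+ n) (+ d)) ⟩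
    mkℚᵘ (+ n) 0                                ≈⟨ toℚᵘ-/ (+ n) 1 ⟨
    toℚᵘ (ι n)                                  ∎)
    where
    open ℚᵘ.≃-Reasoning
    cancel : ∀ x y → x ℤ.* y ℤ.* + 1 ≡ x ℤ.* (y ℤ.* + 1)
    cancel = solve-∀

  0≤ι : ∀ n → 0ℚ ≤ ι n
  0≤ι n = nonNegative⁻¹ (ι n) {{normalize-nonNeg n 1}}

  ι-pos : ∀ n .{{_ : ℕ.NonZero n}} → Positive (ι n)
  ι-pos n = normalize-pos n 1

  ι-mono-≤ : ∀ {m n} → m ℕ.≤ n → ι m ≤ ι n
  ι-mono-≤ {m} {n} m≤n = begin
    ι m                  ≡⟨ +-identityʳ (ι m) ⟨
    ι m + 0ℚ             ≤⟨ +-monoʳ-≤ (ι m) (0≤ι (n ℕ.∸ m)) ⟩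
    ι m + ι (n ℕ.∸ m)    ≡⟨ ι-+ m (n ℕ.∸ m) ⟨
    ι (m ℕ.+ (n ℕ.∸ m))  ≡⟨ cong ι (ℕ.m+[n∸m]≡n m≤n) ⟩
    ι n                  ∎
    where open ≤-Reasoning

module RationalProperties where
  open import Data.Rational
  open import Data.Rational.Properties
  open import Data.Rational.Solver using (module +-*-Solver)
  open import Data.Sum using (inj₁; inj₂)
  open import Data.Empty using (⊥-elim)
  open import Relation.Nullary using (yes; no)
  open import Relation.Binary.PropositionalEquality
  open +-*-Solver

  *-cancelʳ-≡-pos : ∀ r .{{_ : Positive r}} {p q} → p * r ≡ q * r → p ≡ q
  *-cancelʳ-≡-pos r pr≡qr = ≤-antisym (*-cancelʳ-≤-pos r (≤-reflexive pr≡qr)) (*-cancelʳ-≤-pos r (≤-reflexive (sym pr≡qr)))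

  inv-inverseˡ : ∀ p → p ≢ 0ℚ → inv p * p ≡ 1ℚ
  inv-inverseˡ p p≢0 with p ≟ 0ℚ
  ... | yes p≡0 = ⊥-elim (p≢0 p≡0)
  ... | no p≢0′ = *-inverseˡ p {{≢-nonZero p≢0′}}

  p≤∣p∣ : ∀ p → p ≤ ∣ p ∣
  p≤∣p∣ p with ∣p∣≡p∨∣p∣≡-p p
  ... | inj₁ ∣p∣≡p  = ≤-reflexive (sym ∣p∣≡p)
  ... | inj₂ ∣p∣≡-p = ≤-trans p≤0 (0≤∣p∣ p)
    where
    p≤0 : p ≤ 0ℚ
    p≤0 = subst (_≤ 0ℚ) (solve 1 (λ p → :- :- p := p) refl p) (neg-antimono-≤ (subst (0ℚ ≤_) ∣p∣≡-p (0≤∣p∣ p)))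

  ∣p∣<r : ∀ {p r} → p < r → - p < r → ∣ p ∣ < r
  ∣p∣<r {p} p<r -p<r with ∣p∣≡p∨∣p∣≡-p p
  ... | inj₁ ∣p∣≡p  = subst (_< _) (sym ∣p∣≡p) p<r
  ... | inj₂ ∣p∣≡-p = subst (_< _) (sym ∣p∣≡-p) -p<r

  ∣p-q∣≡∣q-p∣ : ∀ p q → ∣ p - q ∣ ≡ ∣ q - p ∣
  ∣p-q∣≡∣q-p∣ p q = trans (cong ∣_∣ (solve 2 (λ p q → p :- q := :- (q :- p)) refl p q)) (∣-p∣≡∣p∣ (q - p))

  ∣-p-[-q]∣≡∣p-q∣ : ∀ p q → ∣ - p - - q ∣ ≡ ∣ p - q ∣
  ∣-p-[-q]∣≡∣p-q∣ p q = trans (cong ∣_∣ (solve 2 (λ p q → :- p :- :- q := :- (p :- q)) refl p q)) (∣-p∣≡∣p∣ (p - q))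

  ∣[p-q]-[r-s]∣≤∣p-r∣+∣q-s∣ : ∀ p q r s → ∣ (p - q) - (r - s) ∣ ≤ ∣ p - r ∣ + ∣ q - s ∣
  ∣[p-q]-[r-s]∣≤∣p-r∣+∣q-s∣ p q r s =
    subst (_≤ ∣ p - r ∣ + ∣ q - s ∣) (cong ∣_∣ (solve 4 (λ p q r s → (p :- r) :- (q :- s) := (p :- q) :- (r :- s)) refl p q r s))
      (∣p-q∣≤∣p∣+∣q∣ (p - r) (q - s))

module CentralBinomialSequence where
  open import Data.Nat as ℕ using (ℕ; suc)
  import Data.Nat.Properties as ℕ
  open import Data.Nat.Combinatorics using (_C_)
  open import Data.Rational
  open import Data.Rational.Properties
  open import Data.Rational.Solver using (module +-*-Solver)
  open import Relation.Binary.PropositionalEquality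
  open import Data.Nat.Tactic.RingSolver using (solve-∀)
  open +-*-Solver
  open ≡-Reasoning
  open CentralBinomial using ([2+2n]*[2+2n]C[1+n]≡4*[1+2n]*[2n]Cn)
  open NatCast
  open RationalProperties

  a*4^n≡ι[2nCn] : ∀ n → a n * ι (4 ℕ.^ n) ≡ ι ((2 ℕ.* n) C n)
  a*4^n≡ι[2nCn] n = [+n/d]*ι[d]≡ι[n] ((2 ℕ.* n) C n) (4 ℕ.^ n)
    where instance _ = ℕ.m^n≢0 4 n

  a[1+n]*ι[2+2n]≡a[n]*ι[1+2n] : ∀ n → a (suc n) * ι (2 ℕ.* suc n) ≡ a n * ι (suc (2 ℕ.* n))
  a[1+n]*ι[2+2n]≡a[n]*ι[1+2n] n = *-cancelʳ-≡-pos (ι (4 ℕ.^ suc n)) (begin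
    a (suc n) * ι (2 ℕ.* suc n) * ι (4 ℕ.^ suc n)   ≡⟨ solve 3 (λ x y z → x :* y :* z := y :* (x :* z)) refl (a (suc n)) _ _ ⟩
    ι (2 ℕ.* suc n) * (a (suc n) * ι (4 ℕ.^ suc n)) ≡⟨ cong (ι (2 ℕ.* suc n) *_) (a*4^n≡ι[2nCn] (suc n)) ⟩
    ι (2 ℕ.* suc n) * ι C₁                           ≡⟨ ι-* (2 ℕ.* suc n) C₁ ⟨
    ι (2 ℕ.* suc n ℕ.* C₁)                           ≡⟨ cong ι ([2+2n]*[2+2n]C[1+n]≡4*[1+2n]*[2n]Cn n) ⟩
    ι (4 ℕ.* (suc (2 ℕ.* n)) ℕ.* C₀)                 ≡⟨ trans (ι-* (4 ℕ.* (suc (2 ℕ.* n))) C₀) (cong (_* ι C₀) (ι-* 4 (suc (2 ℕ.* n)))) ⟩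
    ι 4 * ι (suc (2 ℕ.* n)) * ι C₀                   ≡⟨ cong (ι 4 * ι (suc (2 ℕ.* n)) *_) (a*4^n≡ι[2nCn] n) ⟨
    ι 4 * ι (suc (2 ℕ.* n)) * (a n * ι (4 ℕ.^ n))    ≡⟨ solve 4 (λ f t x d → f :* t :* (x :* d) := x :* t :* (f :* d)) refl (ι 4) _ (a n) _ ⟩
    a n * ι (suc (2 ℕ.* n)) * (ι 4 * ι (4 ℕ.^ n))    ≡⟨ cong (a n * ι (suc (2 ℕ.* n)) *_) (ι-* 4 (4 ℕ.^ n)) ⟨
    a n * ι (suc (2 ℕ.* n)) * ι (4 ℕ.^ suc n)        ∎)
    where
    instance _ = ι-pos (4 ℕ.^ suc n) {{ℕ.m^n≢0 4 (suc n)}}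
    C₀ = (2 ℕ.* n) C n
    C₁ = (2 ℕ.* suc n) C suc n

  inv[2n-1] : ℕ → ℚ
  inv[2n-1] n = inv (ι (2 ℕ.* n) - 1ℚ)

  ι[2+2n]≡ι[1+2n]+1 : ∀ n → ι (2 ℕ.* suc n) ≡ ι (suc (2 ℕ.* n)) + 1ℚ
  ι[2+2n]≡ι[1+2n]+1 n = trans (cong ι (2[1+n]≡[1+2n]+1 n)) (ι-+ (suc (2 ℕ.* n)) 1)
    where
    2[1+n]≡[1+2n]+1 : ∀ n → 2 ℕ.* suc n ≡ suc (2 ℕ.* n) ℕ.+ 1
    2[1+n]≡[1+2n]+1 = solve-∀

  inv[2n-1]-suc : ∀ n → inv[2n-1] (suc n) * ι (suc (2 ℕ.* n)) ≡ 1ℚ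
  inv[2n-1]-suc n = subst (λ x → inv x * t ≡ 1ℚ) (sym ι[2+2n]-1≡t) (inv-inverseˡ t t≢0)
    where
    t = ι (suc (2 ℕ.* n))
    t≢0 : t ≢ 0ℚ
    t≢0 = ≢-sym (<⇒≢ (positive⁻¹ t {{ι-pos (suc (2 ℕ.* n))}}))
    ι[2+2n]-1≡t : ι (2 ℕ.* suc n) - 1ℚ ≡ t
    ι[2+2n]-1≡t = trans (cong (_- 1ℚ) (ι[2+2n]≡ι[1+2n]+1 n)) (solve 1 (λ x → x :+ con 1ℚ :- con 1ℚ := x) refl t)

  a[1+n]*inv[2n+1]*ι[2+2n]≡a[n] : ∀ n → a (suc n) * inv[2n-1] (suc n) * ι (2 ℕ.* suc n) ≡ a n
  a[1+n]*inv[2n+1]*ι[2+2n]≡a[n] n = begin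
    a (suc n) * w * ι (2 ℕ.* suc n)   ≡⟨ solve 3 (λ x w u → x :* w :* u := w :* (x :* u)) refl (a (suc n)) w _ ⟩
    w * (a (suc n) * ι (2 ℕ.* suc n)) ≡⟨ cong (w *_) (a[1+n]*ι[2+2n]≡a[n]*ι[1+2n] n) ⟩
    w * (a n * t)                     ≡⟨ solve 3 (λ x w t → w :* (x :* t) := x :* (w :* t)) refl (a n) w t ⟩
    a n * (w * t)                     ≡⟨ cong (a n *_) (inv[2n-1]-suc n) ⟩
    a n * 1ℚ                          ≡⟨ *-identityʳ (a n) ⟩
    a n                               ∎
    where
    w = inv[2n-1] (suc n)
    t = ι (suc (2 ℕ.* n))

  a[n]≡a[1+n]+a[1+n]*inv[2n+1] : ∀ n → a n ≡ a (suc n) + a (suc n) * inv[2n-1] (suc n)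
  a[n]≡a[1+n]+a[1+n]*inv[2n+1] n = begin
    a n                                 ≡⟨ a[1+n]*inv[2n+1]*ι[2+2n]≡a[n] n ⟨
    a (suc n) * w * ι (2 ℕ.* suc n)     ≡⟨ cong (a (suc n) * w *_) (ι[2+2n]≡ι[1+2n]+1 n) ⟩
    a (suc n) * w * (t + 1ℚ)            ≡⟨ solve 3 (λ x w t → x :* w :* (t :+ con 1ℚ) := x :* (w :* t) :+ x :* w) refl (a (suc n)) w t ⟩
    a (suc n) * (w * t) + a (suc n) * w ≡⟨ cong (λ u → a (suc n) * u + a (suc n) * w) (inv[2n-1]-suc n) ⟩
    a (suc n) * 1ℚ + a (suc n) * w      ≡⟨ cong (_+ a (suc n) * w) (*-identityʳ (a (suc n))) ⟩
    a (suc n) + a (suc n) * w           ∎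
    where
    w = inv[2n-1] (suc n)
    t = ι (suc (2 ℕ.* n))

module Telescoping (g : ℕ → ℚ) where
  open import Data.Nat as ℕ using (ℕ; zero; suc)
  open import Data.Rational
  open import Data.Rational.Solver using (module +-*-Solver)
  open import Relation.Binary.PropositionalEquality
  open +-*-Solver
  open ≡-Reasoning
  open CentralBinomialSequence

  partialSum lhs rhs : ℕ → ℚ
  partialSum n = sumBelow (suc n) g
  lhs N = sumBelow (suc N) (λ n₀ → a n₀ * inv[2n-1] n₀ * sumBelow n₀ g)
  rhs N = sumBelow (suc N) (λ n₁ → a n₁ * g n₁)

  rhs-lhs≡a*partialSum : ∀ N → rhs N - lhs N ≡ a N * partialSum N
  rhs-lhs≡a*partialSum zero =
    solve 3 (λ x w g → (con 0ℚ :+ x :* g) :- (con 0ℚ :+ x :* w :* con 0ℚ) := x :* (con 0ℚ :+ g)) refl (a 0) (inv[2n-1] 0) (g 0)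
  rhs-lhs≡a*partialSum (suc N) = begin
    (rhs N + a′ * g′) - (lhs N + a′ * w * S)  ≡⟨ solve 6 (λ r l x g w s → (r :+ x :* g) :- (l :+ x :* w :* s) := (r :- l) :+ x :* g :- x :* w :* s) refl (rhs N) (lhs N) a′ g′ w S ⟩
    (rhs N - lhs N) + a′ * g′ - a′ * w * S    ≡⟨ cong (λ u → u + a′ * g′ - a′ * w * S) (rhs-lhs≡a*partialSum N) ⟩
    a N * S + a′ * g′ - a′ * w * S            ≡⟨ cong (λ u → u * S + a′ * g′ - a′ * w * S) (a[n]≡a[1+n]+a[1+n]*inv[2n+1] N) ⟩
    (a′ + a′ * w) * S + a′ * g′ - a′ * w * S  ≡⟨ solve 4 (λ x w s g → (x :+ x :* w) :* s :+ x :* g :- x :* w :* s := x :* (s :+ g)) refl a′ w S g′ ⟩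
    a′ * (S + g′)                             ∎
    where
    a′ = a (suc N)
    g′ = g (suc N)
    w = inv[2n-1] (suc N)
    S = partialSum N

  [lhs[1+N]-lhs[N]]*ι[2+2N]≡rhs-lhs : ∀ N → (lhs (suc N) - lhs N) * ι (2 ℕ.* suc N) ≡ rhs N - lhs N
  [lhs[1+N]-lhs[N]]*ι[2+2N]≡rhs-lhs N = begin
    (lhs N + a′ * w * S - lhs N) * ι (2 ℕ.* suc N) ≡⟨ solve 5 (λ l x w s u → (l :+ x :* w :* s :- l) :* u := (x :* w :* u) :* s) refl (lhs N) a′ w S _ ⟩
    (a′ * w * ι (2 ℕ.* suc N)) * S                ≡⟨ cong (_* S) (a[1+n]*inv[2n+1]*ι[2+2n]≡a[n] N) ⟩
    a N * S                                        ≡⟨ rhs-lhs≡a*partialSum N ⟨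
    rhs N - lhs N                                  ∎
    where
    a′ = a (suc N)
    w = inv[2n-1] (suc N)
    S = partialSum N

module Convergence where
  open import Data.Nat as ℕ using (ℕ; zero; suc)
  import Data.Nat.Properties as ℕ
  open import Data.Integer using (+_)
  open import Data.Rational
  open import Data.Rational.Properties
  open import Data.Rational.Solver using (module +-*-Solver)
  open import Data.Product using (_,_; proj₁; proj₂)
  open import Relation.Nullary using (¬_)
  open import Relation.Binary.PropositionalEquality
  open import Data.Nat.Tactic.RingSolver using (solve-∀)
  open +-*-Solver
  open NatCast
  open RationalProperties

  telescope-≥ : ∀ (f : ℕ → ℚ) c P m → (∀ i → i ℕ.< m → c ≤ f (suc (P ℕ.+ i)) - f (P ℕ.+ i)) →
                ι m * c ≤ f (P ℕ.+ m) - f P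
  telescope-≥ f c P zero _ = begin
    0ℚ * c              ≡⟨ *-zeroˡ c ⟩
    0ℚ                  ≡⟨ +-inverseʳ (f P) ⟨
    f P - f P           ≡⟨ cong (λ k → f k - f P) (ℕ.+-identityʳ P) ⟨
    f (P ℕ.+ 0) - f P   ∎
    where open ≤-Reasoning
  telescope-≥ f c P (suc m) increment≥c = begin
    ι (suc m) * c                                              ≡⟨ cong (_* c) (ι-+ 1 m) ⟩
    (1ℚ + ι m) * c                                             ≡⟨ solve 2 (λ k c → (con 1ℚ :+ k) :* c := k :* c :+ c) refl (ι m) c ⟩
    ι m * c + c                                                ≤⟨ +-mono-≤ earlier (increment≥c m (ℕ.n<1+n m)) ⟩
    (f (P ℕ.+ m) - f P) + (f (suc (P ℕ.+ m)) - f (P ℕ.+ m))    ≡⟨ solve 3 (λ x y z → (x :- y) :+ (z :- x) := z :- y) refl (f (P ℕ.+ m)) (f P) (f (suc (P ℕ.+ m))) ⟩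
    f (suc (P ℕ.+ m)) - f P                                    ≡⟨ cong (λ k → f k - f P) (ℕ.+-suc P m) ⟨
    f (P ℕ.+ suc m) - f P                                      ∎
    where
    open ≤-Reasoning
    earlier : ι m * c ≤ f (P ℕ.+ m) - f P
    earlier = telescope-≥ f c P m (λ i i<m → increment≥c i (ℕ.m<n⇒m<1+n i<m))

  module _ (L y : ℕ → ℚ) (step : ∀ n → (L (suc n) - L n) * ι (2 ℕ.* suc n) ≡ y n) where

    y≤[L[1+n]-L[n]]*W : ∀ {n W} → 0ℚ ≤ y n → ι (2 ℕ.* suc n) ≤ W → y n ≤ (L (suc n) - L n) * W
    y≤[L[1+n]-L[n]]*W {n} {W} 0≤y k≤W = begin
      y n     ≡⟨ step n ⟨
      Δ * k   ≤⟨ *-monoˡ-≤-nonNeg Δ {{nonNegative 0≤Δ}} k≤W ⟩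
      Δ * W   ∎
      where
      open ≤-Reasoning
      Δ = L (suc n) - L n
      k = ι (2 ℕ.* suc n)
      0≤Δ : 0ℚ ≤ Δ
      0≤Δ = *-cancelʳ-≤-pos k {{ι-pos (2 ℕ.* suc n)}} (begin
        0ℚ * k  ≡⟨ *-zeroˡ k ⟩
        0ℚ      ≤⟨ 0≤y ⟩
        y n     ≡⟨ step n ⟨
        Δ * k   ∎)

    ι[P]*c≤[L[P+P]-L[P]]*W : ∀ P {c} → 0ℚ ≤ c → (∀ n → P ℕ.≤ n → c ≤ y n) →
                             ι P * c ≤ (L (P ℕ.+ P) - L P) * ι (2 ℕ.* (P ℕ.+ P))
    ι[P]*c≤[L[P+P]-L[P]]*W P {c} 0≤c c≤y = subst (ι P * c ≤_) (*-distribʳ-minus W (L (P ℕ.+ P)) (L P))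
      (telescope-≥ (λ n → L n * W) c P P c≤ΔL*W)
      where
      W = ι (2 ℕ.* (P ℕ.+ P))
      *-distribʳ-minus : ∀ w u v → u * w - v * w ≡ (u - v) * w
      *-distribʳ-minus w u v = solve 3 (λ w u v → u :* w :- v :* w := (u :- v) :* w) refl w u v
      c≤ΔL*W : ∀ i → i ℕ.< P → c ≤ L (suc (P ℕ.+ i)) * W - L (P ℕ.+ i) * W
      c≤ΔL*W i i<P = begin
        c                                       ≤⟨ c≤y (P ℕ.+ i) (ℕ.m≤m+n P i) ⟩
        y (P ℕ.+ i)                             ≤⟨ y≤[L[1+n]-L[n]]*W 0≤y (ι-mono-≤ (ℕ.*-monoʳ-≤ 2 (ℕ.+-monoʳ-< P i<P))) ⟩
        (L (suc (P ℕ.+ i)) - L (P ℕ.+ i)) * W   ≡⟨ *-distribʳ-minus W (L (suc (P ℕ.+ i))) (L (P ℕ.+ i)) ⟨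
        L (suc (P ℕ.+ i)) * W - L (P ℕ.+ i) * W ∎
        where
        open ≤-Reasoning
        0≤y : 0ℚ ≤ y (P ℕ.+ i)
        0≤y = ≤-trans 0≤c (c≤y (P ℕ.+ i) (ℕ.m≤m+n P i))

    -- If the gap stayed above 4δ on [P, 2P), L would grow by at least δ there.
    y[1+p]<6δ : ∀ p {δ} → 0ℚ < δ →
                (∀ n → suc p ℕ.≤ n → ∣ y n - y (suc p) ∣ < δ + δ) →
                ∣ L (suc p ℕ.+ suc p) - L (suc p) ∣ < δ →
                y (suc p) < ι 6 * δ
    y[1+p]<6δ p {δ} 0<δ y-close L-close = ≰⇒> 6δ≰y[P]
      where
      P = suc p
      W = ι (2 ℕ.* (P ℕ.+ P))
      6δ≰y[P] : ¬ (ι 6 * δ ≤ y P)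
      6δ≰y[P] 6δ≤y[P] = <-irrefl refl (begin-strict
        δ                        ≤⟨ *-cancelʳ-≤-pos W {{ι-pos (2 ℕ.* (P ℕ.+ P))}} δ*W≤ΔL*W ⟩
        L (P ℕ.+ P) - L P        ≤⟨ p≤∣p∣ _ ⟩
        ∣ L (P ℕ.+ P) - L P ∣    <⟨ L-close ⟩
        δ                        ∎)
        where
        open ≤-Reasoning
        4δ≤y : ∀ n → P ℕ.≤ n → ι 4 * δ ≤ y n
        4δ≤y n P≤n = begin
          ι 4 * δ              ≡⟨ solve 1 (λ d → con (ι 4) :* d := con (ι 6) :* d :- (d :+ d)) refl δ ⟩
          ι 6 * δ - (δ + δ)    ≤⟨ +-mono-≤ 6δ≤y[P] (neg-antimono-≤ (<⇒≤ y[P]-y[n]<2δ)) ⟩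
          y P - (y P - y n)    ≡⟨ solve 2 (λ u v → u :- (u :- v) := v) refl (y P) (y n) ⟩
          y n                  ∎
          where
          y[P]-y[n]<2δ : y P - y n < δ + δ
          y[P]-y[n]<2δ = ≤-<-trans (p≤∣p∣ _) (subst (_< δ + δ) (∣p-q∣≡∣q-p∣ (y n) (y P)) (y-close n P≤n))
        0≤4δ : 0ℚ ≤ ι 4 * δ
        0≤4δ = nonNegative⁻¹ (ι 4 * δ) {{pos⇒nonNeg (ι 4 * δ) {{pos*pos⇒pos (ι 4) δ {{positive 0<δ}}}}}}
        δ*W≤ΔL*W : δ * W ≤ (L (P ℕ.+ P) - L P) * W
        δ*W≤ΔL*W = subst (_≤ (L (P ℕ.+ P) - L P) * W) P*4δ≡δ*W (ι[P]*c≤[L[P+P]-L[P]]*W P 0≤4δ 4δ≤y)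
          where
          4P≡2[P+P] : ∀ P → 4 ℕ.* P ≡ 2 ℕ.* (P ℕ.+ P)
          4P≡2[P+P] = solve-∀
          P*4δ≡δ*W : ι P * (ι 4 * δ) ≡ δ * W
          P*4δ≡δ*W = trans (solve 2 (λ p d → p :* (con (ι 4) :* d) := d :* (con (ι 4) :* p)) refl (ι P) δ)
                           (cong (δ *_) (trans (sym (ι-* 4 P)) (cong ι (4P≡2[P+P] P))))

  weightedStep⇒sameLimit : ∀ (L R : ℕ → ℚ) → (∀ n → (L (suc n) - L n) * ι (2 ℕ.* suc n) ≡ R n - L n) →
                           Cauchy L → Cauchy R → SameLimit L R
  weightedStep⇒sameLimit L R step cauchyL cauchyR ε ε>0 = P , ∣L-R∣<ε
    where
    y : ℕ → ℚ
    y n = R n - L n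
    δ : ℚ
    δ = ε * (+ 1 / 8)
    0<δ : 0ℚ < δ
    0<δ = positive⁻¹ δ {{pos*pos⇒pos ε {{ε>0}} (+ 1 / 8)}}
    N₁ N₂ p P : ℕ
    N₁ = proj₁ (cauchyL δ (positive 0<δ))
    N₂ = proj₁ (cauchyR δ (positive 0<δ))
    p = N₁ ℕ.+ N₂
    P = suc p
    L-close : ∀ m n → P ℕ.≤ m → P ℕ.≤ n → ∣ L m - L n ∣ < δ
    L-close m n P≤m P≤n = proj₂ (cauchyL δ (positive 0<δ)) m n (ℕ.≤-trans N₁≤P P≤m) (ℕ.≤-trans N₁≤P P≤n)
      where
      N₁≤P : N₁ ℕ.≤ P
      N₁≤P = ℕ.m≤n⇒m≤1+n (ℕ.m≤m+n N₁ N₂)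
    R-close : ∀ m n → P ℕ.≤ m → P ℕ.≤ n → ∣ R m - R n ∣ < δ
    R-close m n P≤m P≤n = proj₂ (cauchyR δ (positive 0<δ)) m n (ℕ.≤-trans N₂≤P P≤m) (ℕ.≤-trans N₂≤P P≤n)
      where
      N₂≤P : N₂ ℕ.≤ P
      N₂≤P = ℕ.m≤n⇒m≤1+n (ℕ.m≤n+m N₂ N₁)
    y-close : ∀ n → P ℕ.≤ n → ∣ y n - y P ∣ < δ + δ
    y-close n P≤n = ≤-<-trans (∣[p-q]-[r-s]∣≤∣p-r∣+∣q-s∣ (R n) (L n) (R P) (L P))
                              (+-mono-< (R-close n P P≤n ℕ.≤-refl) (L-close n P P≤n ℕ.≤-refl))
    ΔL-close : ∣ L (P ℕ.+ P) - L P ∣ < δ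
    ΔL-close = L-close (P ℕ.+ P) P (ℕ.m≤m+n P P) ℕ.≤-refl
    negated-step : ∀ n → (- L (suc n) - - L n) * ι (2 ℕ.* suc n) ≡ - y n
    negated-step n = trans (solve 3 (λ u v k → (:- u :- :- v) :* k := :- ((u :- v) :* k)) refl (L (suc n)) (L n) (ι (2 ℕ.* suc n)))
                    (cong -_ (step n))
    ∣y[P]∣<6δ : ∣ y P ∣ < ι 6 * δ
    ∣y[P]∣<6δ = ∣p∣<r (y[1+p]<6δ L y step p 0<δ y-close ΔL-close)
                      (y[1+p]<6δ (λ n → - L n) (λ n → - y n) negated-step p 0<δ
                        (λ n P≤n → subst (_< δ + δ) (sym (∣-p-[-q]∣≡∣p-q∣ (y n) (y P))) (y-close n P≤n))
                        (subst (_< δ) (sym (∣-p-[-q]∣≡∣p-q∣ (L (P ℕ.+ P)) (L P))) ΔL-close))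
    ∣L-R∣<ε : ∀ M → P ℕ.≤ M → ∣ L M - R M ∣ < ε
    ∣L-R∣<ε M P≤M = begin-strict
      ∣ L M - R M ∣                ≡⟨ ∣p-q∣≡∣q-p∣ (L M) (R M) ⟩
      ∣ y M ∣                      ≡⟨ cong ∣_∣ (solve 2 (λ u v → u := (u :- v) :+ v) refl (y M) (y P)) ⟩
      ∣ (y M - y P) + y P ∣        ≤⟨ ∣p+q∣≤∣p∣+∣q∣ (y M - y P) (y P) ⟩
      ∣ y M - y P ∣ + ∣ y P ∣      <⟨ +-mono-< (y-close M P≤M) ∣y[P]∣<6δ ⟩
      (δ + δ) + ι 6 * δ            ≡⟨ solve 1 (λ e → e :* con (+ 1 / 8) :+ e :* con (+ 1 / 8) :+ con (ι 6) :* (e :* con (+ 1 / 8)) := e) refl ε ⟩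
      ε                            ∎
      where open ≤-Reasoning

open import Data.Bool using (Bool)
open import Data.Nat using (ℕ; suc; _≤_)
open import Data.Vec using (Vec)
open import Data.Vec.Relation.Unary.All using (All)

mainTheorem6 : (k : ℕ) (cs : Vec Bool (suc k)) (ls : Vec LChoice (suc k)) (ss : Vec ℕ (suc k))
    → All (1 ≤_) ss
    → (∀ n → Defined cs ls ss n)
    → Cauchy (LHSPartial cs ls ss)
    → Cauchy (RHSPartial cs ls ss)
    → SameLimit (LHSPartial cs ls ss) (RHSPartial cs ls ss)
mainTheorem6 k cs ls ss _ _ =
  weightedStep⇒sameLimit (lhs (G cs ls ss)) (rhs (G cs ls ss)) ([lhs[1+N]-lhs[N]]*ι[2+2N]≡rhs-lhs (G cs ls ss))
  where
  open Telescoping using (lhs; rhs; [lhs[1+N]-lhs[N]]*ι[2+2N]≡rhs-lhs)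
  open Convergence using (weightedStep⇒sameLimit)
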